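{- Let $p$ be an odd prime, $n\ge 1$, $k=2n$, and let $\chi$ be a Dirichlet character of conductor $p^k$ with $\ell_{\chi} \equiv -1 \pmod{p^{n}}$. Then for every $\psi \in \chi H_{p^{n}}$, \[ \tau(\psi) = p^n e_{p^k}(1) = p^n \big(1+ O(p^{ -k})\big). \]
   Context: Notation: $e(x)=\exp(2\pi i x)$, $e_r(x)=e(x/r)$, and $\tau(\psi)=\sum_{t \bmod p^k}\psi(t)e_{p^k}(t)$ is the Gauss sum. $H_{p^n}$ is the group of Dirichlet characters modulo $p^n$, viewed inside the characters modulo $p^k$, and $\chi H_{p^n}=\{\chi\psi':\psi'\in H_{p^n}\}$. For $\chi$ of conductor $p^k$ with $k\ge2$, $\ell_\chi\in\mathbb{Z}/p^{k-1}\mathbb{Z}$ is defined by $\chi(1+px)=e_{p^k}(\ell_\chi\log(1+px))$ for all integers $x$, with $\log$ the $p$-adic logarithm. -}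

module Defs where

open import Level using (Level)
open import Data.Nat as ℕ using (ℕ; zero; suc; _≤_; _<_)
open import Data.Nat.Divisibility using (_∣_)
open import Data.Nat.Coprimality using (Coprime)
open import Data.Nat.Primality using (Prime)
open import Data.Integer as ℤ using (ℤ; +_; -[1+_])
import Data.Integer.Divisibility as ℤD
open import Data.Rational as ℚ using (ℚ)
open import Data.Product using (Σ; _×_; ∃)
open import Data.Sum using (_⊎_)
open import Relation.Nullary using (¬_)
open import Relation.Binary.PropositionalEquality using (_≡_)
open import Algebra.Bundles using (CommutativeRing)

-- Everything is relative to a commutative ring R (the values of characters).
module _ {c ℓ : Level} (R : CommutativeRing c ℓ) where
  open CommutativeRing R

  pow : Carrier → ℕ → Carrier
  pow x zero    = 1#
  pow x (suc m) = x * pow x m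

  natR : ℕ → Carrier
  natR zero    = 0#
  natR (suc m) = 1# + natR m

  -- R is an integral domain of characteristic zero
  -- (so that it behaves like the subring ℤ[ζ] of ℂ)
  IsDomain : Set (c Level.⊔ ℓ)
  IsDomain = (¬ (1# ≈ 0#)) × (∀ x y → x * y ≈ 0# → (x ≈ 0#) ⊎ (y ≈ 0#))

  CharZero : Set ℓ
  CharZero = ∀ m → ¬ (natR (suc m) ≈ 0#)

  -- ζ is a primitive N-th root of unity (plays the role of e(1/N))
  IsPrimitiveRoot : ℕ → Carrier → Set ℓ
  IsPrimitiveRoot N ζ = (pow ζ N ≈ 1#) × (∀ d → 0 < d → d < N → ¬ (pow ζ d ≈ 1#))

  -- integer powers of ζ, where ζ is known to satisfy ζ^N = 1
  -- (so ζ^{-1} = ζ^{N-1})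
  zpow : ℕ → Carrier → ℤ → Carrier
  zpow N ζ (+ a)      = pow ζ a
  zpow N ζ -[1+ a ]   = pow (pow ζ (N ℕ.∸ 1)) (suc a)

  -- With N = p^k (p - 1) and ζ = e(1/N):  e_{p^k}(m) = e(m/p^k) = ζ^{(p-1) m}
  ModulusN : ℕ → ℕ → ℕ
  ModulusN p k = (p ℕ.^ k) ℕ.* (p ℕ.∸ 1)

  eP : ℕ → ℕ → Carrier → ℤ → Carrier
  eP p k ζ m = zpow (ModulusN p k) ζ (ℤ.+ (p ℕ.∸ 1) ℤ.* m)

  record IsDirichletChar (q : ℕ) (χ : ℕ → Carrier) : Set (c Level.⊔ ℓ) where
    field
      periodic       : ∀ a → χ (a ℕ.+ q) ≈ χ a
      multiplicative : ∀ a b → χ (a ℕ.* b) ≈ χ a * χ b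
      one            : χ 1 ≈ 1#
      vanish         : ∀ a → ¬ Coprime a q → χ a ≈ 0#
      nonvanish      : ∀ a → Coprime a q → ¬ (χ a ≈ 0#)

  -- χ (a character mod q) has conductor q, i.e. is primitive: for every
  -- proper divisor d of q, χ is not trivial on {a coprime to q, a ≡ 1 mod d}
  HasConductor : ℕ → (ℕ → Carrier) → Set (c Level.⊔ ℓ)
  HasConductor q χ =
    IsDirichletChar q χ ×
    (∀ d → d ∣ q → d < q →
       Σ ℕ λ t → Coprime (1 ℕ.+ d ℕ.* t) q × ¬ (χ (1 ℕ.+ d ℕ.* t) ≈ 1#))

  sumR : ℕ → (ℕ → Carrier) → Carrier
  sumR zero    f = 0#
  sumR (suc m) f = sumR m f + f m

  gauss : ℕ → ℕ → Carrier → (ℕ → Carrier) → Carrier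
  gauss p k ζ ψ = sumR (p ℕ.^ k) (λ t → ψ t * eP p k ζ (+ t))

-- Truncated p-adic logarithm of 1 + p x:
--   Σ_{j=1}^{J} (-1)^{j+1} (p x)^j / j   (a rational number)
-- (-1)^i
signℤ : ℕ → ℤ
signℤ zero    = ℤ.1ℤ
signℤ (suc i) = ℤ.- signℤ i

logTrunc : ℕ → ℕ → ℕ → ℚ
logTrunc p x zero    = ℚ.0ℚ
logTrunc p x (suc i) =
  logTrunc p x i ℚ.+
  (signℤ i ℤ.* ((+ (p ℕ.* x)) ℤ.^ suc i)) ℚ./ suc i

-- a rational q is ≡ L (mod p^k) in ℤ_(p):  q - L = p^k a / b with p ∤ b
QCongMod : ℕ → ℕ → ℚ → ℤ → Set
QCongMod p k q L =
  Σ ℤ λ a → Σ ℕ λ b → (¬ (p ∣ b)) ×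
    ((q ℚ.- (L ℚ./ 1)) ℚ.* ((+ b) ℚ./ 1) ≡ ((+ (p ℕ.^ k)) ℤ.* a) ℚ./ 1)

-- L ≡ log_p(1 + p x) (mod p^k).  For odd p every term of the log series
-- with index j > 2k has p-adic valuation ≥ k, so truncation at 2k terms
-- determines log(1+px) modulo p^k.
IsLogMod : ℕ → ℕ → ℕ → ℤ → Set
IsLogMod p k x L = QCongMod p k (logTrunc p x (2 ℕ.* k)) L

-- ℓ_χ ≡ -1 (mod p^n): there is ℓ with ℓ ≡ -1 (mod p^n) and
-- χ(1 + p x) = e_{p^k}(ℓ log(1 + p x)) for all x
-- (ℓ_χ is unique mod p^{k-1}, so this is the same as ℓ_χ ≡ -1 mod p^n, n ≤ k-1).
module _ {c ℓ' : Level} (R : CommutativeRing c ℓ') where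
  open CommutativeRing R

  EllCondition : ℕ → ℕ → ℕ → Carrier → (ℕ → Carrier) → Set ℓ'
  EllCondition p k n ζ χ =
    Σ ℤ λ l → ((+ (p ℕ.^ n)) ℤD.∣ (l ℤ.+ ℤ.1ℤ)) ×
      (∀ x L → IsLogMod p k x L → χ (1 ℕ.+ p ℕ.* x) ≈ eP R p k ζ (l ℤ.* L))

-- Write t mod p^{2n} as x + p^n y with x, y < p^n.  Since ℓ_χ ≡ −1 (mod p^n) and
-- log(1 + p^n m) ≡ p^n m (mod p^{2n}), χ(1 + p^n m) = e_{p^n}(−m).  If p ∤ x and
-- x u ≡ 1 (mod p^n), then χ(x + p^n y) = χ(x) χ(1 + p^n u y), so the summand at x + p^n y
-- is the summand at x times θ^y with θ = e_{p^n}(1 − u): the sum over y is a geometric sum,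
-- which vanishes unless θ = 1, i.e. x = 1.  If p ∣ x every summand vanishes.  Only x = 1
-- survives and contributes p^n e_{p^{2n}}(1).  Apart from the value of χ on 1 + p^n ℤ the
-- argument only uses K = p^n ≥ 2, so the evaluation holds for any modulus K².

module Submission where

open import Defs
open import Algebra.Bundles using (CommutativeRing)
open import Data.Empty using (⊥-elim)
open import Data.List using (_∷_; [])
open import Data.Product using (∃; ∃₂; _×_; _,_; proj₁; proj₂)
open import Data.Sum using (inj₁; inj₂)
open import Function using (_∘_)
open import Relation.Nullary using (¬_; yes; no)
open import Relation.Binary.PropositionalEquality as ≡
  using (_≡_; _≢_; cong; cong₂; subst; subst₂)
open import Data.Nat as ℕ using (ℕ; zero; suc; _≤_; _<_; z≤n; s≤s)
import Data.Nat.Properties as ℕ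
import Algebra.Properties.CommutativeSemigroup ℕ.*-commutativeSemigroup as ℕ*
open import Data.Nat.Divisibility
  using (_∣_; divides; _∣?_; ∣1⇒≡1; ∣m∣n⇒∣m+n; ∣m⇒∣m*n; m∣m*n; n∣m*n)
open import Data.Nat.Coprimality using (Coprime; coprime?; coprime-Bézout)
open import Data.Nat.GCD using (module Bézout)
open import Data.Nat.Induction using (<-rec)
open import Data.Nat.Primality using (Prime; euclidsLemma; prime⇒nonTrivial)
import Data.Nat.Tactic.RingSolver as ℕ-Solver
open import Data.Integer as ℤ using (ℤ; +_; -[1+_])
import Data.Integer.Properties as ℤ
import Algebra.Properties.CommutativeSemigroup ℤ.*-commutativeSemigroup as ℤ*
import Data.Integer.Divisibility.Signed as ℤ
import Data.Integer.Tactic.RingSolver as ℤ-Solver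
open import Data.Rational as ℚ using (ℚ; toℚᵘ)
import Data.Rational.Properties as ℚ
open import Data.Rational.Unnormalised as ℚᵘ using (ℚᵘ; mkℚᵘ; *≡*; ↥_; ↧_)
import Data.Rational.Unnormalised.Properties as ℚᵘ

-- p-adic estimates for the truncated logarithm

p-power-decomposition : ∀ {p} → 2 ≤ p → ∀ j → 0 < j → ∃₂ λ e r → ¬ p ∣ r × j ≡ p ℕ.^ e ℕ.* r
p-power-decomposition {p} p≥2 = <-rec _ split
  where
  split : ∀ j → (∀ {i} → i < j → 0 < i → ∃₂ λ e r → ¬ p ∣ r × i ≡ p ℕ.^ e ℕ.* r) →
          0 < j → ∃₂ λ e r → ¬ p ∣ r × j ≡ p ℕ.^ e ℕ.* r
  split j rec j>0 with p ∣? j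
  ... | no p∤j = 0 , j , p∤j , ≡.sym (ℕ.+-identityʳ j)
  ... | yes (divides q j≡q*p) with rec q<j q>0
    where
    q>0 : 0 < q
    q>0 = ℕ.n≢0⇒n>0 λ { ≡.refl → ℕ.<⇒≢ j>0 (≡.sym j≡q*p) }
    q<j : q < j
    q<j = subst (q <_) (≡.sym j≡q*p) (ℕ.m<m*n q p {{ℕ.>-nonZero q>0}} p≥2)
  ... | e , r , p∤r , q≡p^e*r = suc e , r , p∤r , (begin
    j                      ≡⟨ j≡q*p ⟩
    q ℕ.* p                ≡⟨ cong (ℕ._* p) q≡p^e*r ⟩
    p ℕ.^ e ℕ.* r ℕ.* p    ≡⟨ ℕ.*-comm (p ℕ.^ e ℕ.* r) p ⟩
    p ℕ.* (p ℕ.^ e ℕ.* r)  ≡⟨ ℕ.*-assoc p (p ℕ.^ e) r ⟨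
    p ℕ.^ suc e ℕ.* r      ∎)
    where open ≡.≡-Reasoning

3+e≤p^1+e : ∀ {p} → 3 ≤ p → ∀ e → 3 ℕ.+ e ≤ p ℕ.^ suc e
3+e≤p^1+e {p} p≥3 zero    = ℕ.≤-trans p≥3 (ℕ.≤-reflexive (≡.sym (ℕ.*-identityʳ p)))
3+e≤p^1+e {p} p≥3 (suc e) = begin
  suc (3 ℕ.+ e)  ≤⟨ s≤s (3+e≤p^1+e p≥3 e) ⟩
  suc A          ≤⟨ ℕ.+-monoˡ-≤ A A≥1 ⟩
  A ℕ.+ A        ≡⟨ cong (A ℕ.+_) (ℕ.+-identityʳ A) ⟨
  2 ℕ.* A        ≤⟨ ℕ.*-monoˡ-≤ A (ℕ.≤-trans (s≤s (s≤s z≤n)) p≥3) ⟩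
  p ℕ.* A        ∎
  where
  open ℕ.≤-Reasoning
  A : ℕ
  A = p ℕ.^ suc e
  A≥1 : 1 ≤ A
  A≥1 = ℕ.≤-trans (s≤s z≤n) (3+e≤p^1+e p≥3 e)

e+2n≤n*[p^e*r] : ∀ {p n e r} → 3 ≤ p → 1 ≤ n → ¬ p ∣ r → 2 ≤ p ℕ.^ e ℕ.* r →
                 e ℕ.+ 2 ℕ.* n ≤ n ℕ.* (p ℕ.^ e ℕ.* r)
e+2n≤n*[p^e*r] {n = n} {zero} _ _ _ j≥2 =
  ℕ.≤-trans (ℕ.≤-reflexive (ℕ.*-comm 2 n)) (ℕ.*-monoʳ-≤ n j≥2)
e+2n≤n*[p^e*r] {p} {n} {suc e} {r} p≥3 n≥1 p∤r _ = begin
  suc e ℕ.+ 2 ℕ.* n          ≤⟨ ℕ.+-monoˡ-≤ (2 ℕ.* n) (ℕ.m≤n*m (suc e) n {{ℕ.>-nonZero n≥1}}) ⟩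
  n ℕ.* suc e ℕ.+ 2 ℕ.* n    ≡⟨ ℕ-Solver.solve (n ∷ e ∷ []) ⟩
  n ℕ.* (3 ℕ.+ e)            ≤⟨ ℕ.*-monoʳ-≤ n (3+e≤p^1+e p≥3 e) ⟩
  n ℕ.* p ℕ.^ suc e          ≤⟨ ℕ.*-monoʳ-≤ n (ℕ.m≤m*n (p ℕ.^ suc e) r {{r≢0}}) ⟩
  n ℕ.* (p ℕ.^ suc e ℕ.* r)  ∎
  where
  open ℕ.≤-Reasoning
  r≢0 : ℕ.NonZero r
  r≢0 = ℕ.≢-nonZero λ { ≡.refl → p∤r (divides 0 ≡.refl) }

^-distribʳ-* : ∀ a b j → (a ℕ.* b) ℕ.^ j ≡ a ℕ.^ j ℕ.* b ℕ.^ j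
^-distribʳ-* a b zero    = ≡.refl
^-distribʳ-* a b (suc j) =
  ≡.trans (cong (a ℕ.* b ℕ.*_) (^-distribʳ-* a b j)) (ℕ*.interchange a b _ _)

pos-^ : ∀ a j → (+ a) ℤ.^ j ≡ + (a ℕ.^ j)
pos-^ a zero    = ≡.refl
pos-^ a (suc j) = ≡.trans (cong (+ a ℤ.*_) (pos-^ a j)) (≡.sym (ℤ.pos-* a (a ℕ.^ j)))

module LocalDivisibility {p : ℕ} (pp : Prime p) where

  p∤1 : ¬ p ∣ 1
  p∤1 p∣1 = ℕ.<⇒≢ (ℕ.nonTrivial⇒n>1 p {{prime⇒nonTrivial pp}}) (≡.sym (∣1⇒≡1 p∣1))

  p∤* : ∀ {b c} → ¬ p ∣ b → ¬ p ∣ c → ¬ p ∣ b ℕ.* c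
  p∤* {b} {c} p∤b p∤c p∣bc with euclidsLemma b c pp p∣bc
  ... | inj₁ p∣b = p∤b p∣b
  ... | inj₂ p∣c = p∤c p∣c

  -- P ∣ₚ q : q = P a / b with p ∤ b, i.e. q ∈ P ℤ₍ₚ₎.
  infix 4 _∣ₚ_
  record _∣ₚ_ (P : ℕ) (q : ℚᵘ) : Set where
    constructor localDivides
    field
      a       : ℤ
      b       : ℕ
      p∤b     : ¬ p ∣ b
      q*b≡P*a : ↥ q ℤ.* + b ≡ + P ℤ.* a ℤ.* ↧ q

  ∣ₚ-0 : ∀ P → P ∣ₚ ℚᵘ.0ℚᵘ
  ∣ₚ-0 P = localDivides (+ 0) 1 p∤1 (≡.sym (cong (ℤ._* + 1) (ℤ.*-zeroʳ (+ P))))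

  ∣ₚ-resp-≃ : ∀ {P q r} → q ℚᵘ.≃ r → P ∣ₚ q → P ∣ₚ r
  ∣ₚ-resp-≃ {P} {q} {r} (*≡* q≃r) (localDivides a b p∤b eq) =
    localDivides a b p∤b (ℤ.*-cancelʳ-≡ _ _ (↧ q) (begin
      ↥ r ℤ.* + b ℤ.* ↧ q        ≡⟨ ℤ*.xy∙z≈xz∙y (↥ r) (+ b) (↧ q) ⟩
      ↥ r ℤ.* ↧ q ℤ.* + b        ≡⟨ cong (ℤ._* + b) q≃r ⟨
      ↥ q ℤ.* ↧ r ℤ.* + b        ≡⟨ ℤ*.xy∙z≈xz∙y (↥ q) (↧ r) (+ b) ⟩
      ↥ q ℤ.* + b ℤ.* ↧ r        ≡⟨ cong (ℤ._* ↧ r) eq ⟩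
      + P ℤ.* a ℤ.* ↧ q ℤ.* ↧ r  ≡⟨ ℤ*.xy∙z≈xz∙y (+ P ℤ.* a) (↧ q) (↧ r) ⟩
      + P ℤ.* a ℤ.* ↧ r ℤ.* ↧ q  ∎))
    where open ≡.≡-Reasoning

  ∣ₚ-+ : ∀ {P} q r → P ∣ₚ q → P ∣ₚ r → P ∣ₚ q ℚᵘ.+ r
  ∣ₚ-+ {P} (mkℚᵘ n₁ d₁) (mkℚᵘ n₂ d₂) (localDivides a₁ b₁ p∤b₁ eq₁) (localDivides a₂ b₂ p∤b₂ eq₂) =
    localDivides (a₁ ℤ.* + b₂ ℤ.+ a₂ ℤ.* + b₁) (b₁ ℕ.* b₂) (p∤* p∤b₁ p∤b₂) (begin
      (n₁ ℤ.* D₂ ℤ.+ n₂ ℤ.* D₁) ℤ.* + (b₁ ℕ.* b₂)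
        ≡⟨ cong ((n₁ ℤ.* D₂ ℤ.+ n₂ ℤ.* D₁) ℤ.*_) (ℤ.pos-* b₁ b₂) ⟩
      (n₁ ℤ.* D₂ ℤ.+ n₂ ℤ.* D₁) ℤ.* (+ b₁ ℤ.* + b₂)
        ≡⟨ regroup n₁ n₂ D₁ D₂ (+ b₁) (+ b₂) ⟩
      n₁ ℤ.* + b₁ ℤ.* D₂ ℤ.* + b₂ ℤ.+ n₂ ℤ.* + b₂ ℤ.* D₁ ℤ.* + b₁
        ≡⟨ cong₂ (λ u v → u ℤ.* D₂ ℤ.* + b₂ ℤ.+ v ℤ.* D₁ ℤ.* + b₁) eq₁ eq₂ ⟩
      + P ℤ.* a₁ ℤ.* D₁ ℤ.* D₂ ℤ.* + b₂ ℤ.+ + P ℤ.* a₂ ℤ.* D₂ ℤ.* D₁ ℤ.* + b₁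
        ≡⟨ collect (+ P) a₁ a₂ D₁ D₂ (+ b₁) (+ b₂) ⟩
      + P ℤ.* a ℤ.* (D₁ ℤ.* D₂)
        ≡⟨ cong (+ P ℤ.* a ℤ.*_) (ℤ.pos-* (suc d₁) (suc d₂)) ⟨
      + P ℤ.* a ℤ.* + (suc d₁ ℕ.* suc d₂)
        ∎)
    where
    open ≡.≡-Reasoning
    a D₁ D₂ : ℤ
    a  = a₁ ℤ.* + b₂ ℤ.+ a₂ ℤ.* + b₁
    D₁ = + suc d₁
    D₂ = + suc d₂
    regroup : ∀ n₁ n₂ D₁ D₂ B₁ B₂ →
              (n₁ ℤ.* D₂ ℤ.+ n₂ ℤ.* D₁) ℤ.* (B₁ ℤ.* B₂) ≡
              n₁ ℤ.* B₁ ℤ.* D₂ ℤ.* B₂ ℤ.+ n₂ ℤ.* B₂ ℤ.* D₁ ℤ.* B₁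
    regroup = ℤ-Solver.solve-∀
    collect : ∀ P a₁ a₂ D₁ D₂ B₁ B₂ →
              P ℤ.* a₁ ℤ.* D₁ ℤ.* D₂ ℤ.* B₂ ℤ.+ P ℤ.* a₂ ℤ.* D₂ ℤ.* D₁ ℤ.* B₁ ≡
              P ℤ.* (a₁ ℤ.* B₂ ℤ.+ a₂ ℤ.* B₁) ℤ.* (D₁ ℤ.* D₂)
    collect = ℤ-Solver.solve-∀

  ∣ₚ⇒QCongMod : ∀ {k} q L → p ℕ.^ k ∣ₚ toℚᵘ (q ℚ.- L ℚ./ 1) → QCongMod p k q L
  ∣ₚ⇒QCongMod {k} q L (localDivides a b p∤b eq) = a , b , p∤b , ℚ.toℚᵘ-injective (begin
    toℚᵘ ((q ℚ.- L ℚ./ 1) ℚ.* (+ b ℚ./ 1))  ≈⟨ ℚ.toℚᵘ-homo-* (q ℚ.- L ℚ./ 1) (+ b ℚ./ 1) ⟩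
    Q ℚᵘ.* toℚᵘ (+ b ℚ./ 1)                ≈⟨ ℚᵘ.*-congˡ {Q} (ℚ.toℚᵘ-fromℚᵘ (mkℚᵘ (+ b) 0)) ⟩
    Q ℚᵘ.* mkℚᵘ (+ b) 0                    ≈⟨ clear-denominator Q eq ⟩
    mkℚᵘ (+ P ℤ.* a) 0                     ≈⟨ ℚ.toℚᵘ-fromℚᵘ (mkℚᵘ (+ P ℤ.* a) 0) ⟨
    toℚᵘ (+ P ℤ.* a ℚ./ 1)                 ∎)
    where
    open ℚᵘ.≃-Reasoning
    P : ℕ
    P = p ℕ.^ k
    Q : ℚᵘ
    Q = toℚᵘ (q ℚ.- L ℚ./ 1)
    clear-denominator : ∀ r → ↥ r ℤ.* + b ≡ + P ℤ.* a ℤ.* ↧ r →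
                        r ℚᵘ.* mkℚᵘ (+ b) 0 ℚᵘ.≃ mkℚᵘ (+ P ℤ.* a) 0
    clear-denominator (mkℚᵘ n d) eq = *≡* (≡.trans (ℤ.*-identityʳ _)
      (≡.trans eq (cong (+ P ℤ.* a ℤ.*_) (≡.sym (ℤ.*-identityʳ (+ suc d))))))

  -- For j = p^e r with p ∤ r, the term y^j / j has p-adic valuation at least n j − e ≥ 2n.
  log-term-∣ₚ : 3 ≤ p → ∀ {n y} → 1 ≤ n → p ℕ.^ n ∣ y → ∀ s i → 1 ≤ i →
                p ℕ.^ (2 ℕ.* n) ∣ₚ mkℚᵘ (s ℤ.* (+ y) ℤ.^ suc i) i
  log-term-∣ₚ p≥3 {n} n≥1 (divides m ≡.refl) s i i≥1
    with p-power-decomposition (ℕ.≤-trans (s≤s (s≤s z≤n)) p≥3) (suc i) (s≤s z≤n)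
  ... | e , r , p∤r , j≡p^e*r = localDivides (s ℤ.* + B) r p∤r (begin
    s ℤ.* (+ y) ℤ.^ j ℤ.* + r    ≡⟨ cong (λ t → s ℤ.* t ℤ.* + r) (pos-^ y j) ⟩
    s ℤ.* + (y ℕ.^ j) ℤ.* + r    ≡⟨ ℤ.*-assoc s _ _ ⟩
    s ℤ.* (+ (y ℕ.^ j) ℤ.* + r)  ≡⟨ cong (s ℤ.*_) (ℤ.pos-* (y ℕ.^ j) r) ⟨
    s ℤ.* + (y ℕ.^ j ℕ.* r)      ≡⟨ cong (λ t → s ℤ.* + t) valuation ⟩
    s ℤ.* + (P ℕ.* B ℕ.* j)      ≡⟨ cong (s ℤ.*_) (≡.trans (ℤ.pos-* (P ℕ.* B) j)
                                                           (cong (ℤ._* + j) (ℤ.pos-* P B))) ⟩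
    s ℤ.* (+ P ℤ.* + B ℤ.* + j)  ≡⟨ x[yzw]≡y[xz]w s (+ P) (+ B) (+ j) ⟩
    + P ℤ.* (s ℤ.* + B) ℤ.* + j  ∎)
    where
    open ≡.≡-Reasoning
    y j P t B : ℕ
    y = m ℕ.* p ℕ.^ n
    j = suc i
    P = p ℕ.^ (2 ℕ.* n)
    t = n ℕ.* j ℕ.∸ (e ℕ.+ 2 ℕ.* n)
    B = p ℕ.^ t ℕ.* m ℕ.^ j
    bound : e ℕ.+ 2 ℕ.* n ≤ n ℕ.* j
    bound = subst (λ j → e ℕ.+ 2 ℕ.* n ≤ n ℕ.* j) (≡.sym j≡p^e*r)
              (e+2n≤n*[p^e*r] {e = e} p≥3 n≥1 p∤r (subst (2 ≤_) j≡p^e*r (s≤s i≥1)))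
    x[yzw]≡y[xz]w : ∀ x y z w → x ℤ.* (y ℤ.* z ℤ.* w) ≡ y ℤ.* (x ℤ.* z) ℤ.* w
    x[yzw]≡y[xz]w = ℤ-Solver.solve-∀
    rearrange : ∀ M E P T r → M ℕ.* (E ℕ.* P ℕ.* T) ℕ.* r ≡ P ℕ.* (T ℕ.* M) ℕ.* (E ℕ.* r)
    rearrange = ℕ-Solver.solve-∀
    split-exponent : p ℕ.^ (e ℕ.+ 2 ℕ.* n ℕ.+ t) ≡ p ℕ.^ e ℕ.* P ℕ.* p ℕ.^ t
    split-exponent = ≡.trans (ℕ.^-distribˡ-+-* p (e ℕ.+ 2 ℕ.* n) t)
                             (cong (ℕ._* p ℕ.^ t) (ℕ.^-distribˡ-+-* p e (2 ℕ.* n)))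
    valuation : y ℕ.^ j ℕ.* r ≡ P ℕ.* B ℕ.* j
    valuation = begin
      y ℕ.^ j ℕ.* r
        ≡⟨ cong (ℕ._* r) (^-distribʳ-* m (p ℕ.^ n) j) ⟩
      m ℕ.^ j ℕ.* (p ℕ.^ n) ℕ.^ j ℕ.* r
        ≡⟨ cong (λ u → m ℕ.^ j ℕ.* u ℕ.* r) (ℕ.^-*-assoc p n j) ⟩
      m ℕ.^ j ℕ.* p ℕ.^ (n ℕ.* j) ℕ.* r
        ≡⟨ cong (λ u → m ℕ.^ j ℕ.* p ℕ.^ u ℕ.* r) (ℕ.m+[n∸m]≡n bound) ⟨
      m ℕ.^ j ℕ.* p ℕ.^ (e ℕ.+ 2 ℕ.* n ℕ.+ t) ℕ.* r
        ≡⟨ cong (λ u → m ℕ.^ j ℕ.* u ℕ.* r) split-exponent ⟩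
      m ℕ.^ j ℕ.* (p ℕ.^ e ℕ.* P ℕ.* p ℕ.^ t) ℕ.* r
        ≡⟨ rearrange (m ℕ.^ j) (p ℕ.^ e) P (p ℕ.^ t) r ⟩
      P ℕ.* B ℕ.* (p ℕ.^ e ℕ.* r)
        ≡⟨ cong (P ℕ.* B ℕ.*_) j≡p^e*r ⟨
      P ℕ.* B ℕ.* j
        ∎

  logTrunc-∣ₚ : 3 ≤ p → ∀ {n x} → 1 ≤ n → p ℕ.^ n ∣ p ℕ.* x → ∀ i →
                p ℕ.^ (2 ℕ.* n) ∣ₚ toℚᵘ (logTrunc p x (suc i) ℚ.- + (p ℕ.* x) ℚ./ 1)
  logTrunc-∣ₚ p≥3 {n} {x} n≥1 p^n∣px zero =
    subst (p ℕ.^ (2 ℕ.* n) ∣ₚ_) (cong toℚᵘ (≡.sym first-term-cancels)) (∣ₚ-0 _)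
    where
    Y : ℚ
    Y = + (p ℕ.* x) ℚ./ 1
    first-term : logTrunc p x 1 ≡ Y
    first-term = ≡.trans (ℚ.+-identityˡ _) (cong (ℚ._/ 1)
      (≡.trans (ℤ.*-identityˡ ((+ (p ℕ.* x)) ℤ.^ 1)) (ℤ.^-identityʳ (+ (p ℕ.* x)))))
    first-term-cancels : logTrunc p x 1 ℚ.- Y ≡ ℚ.0ℚ
    first-term-cancels = ≡.trans (cong (ℚ._- Y) first-term) (ℚ.+-inverseʳ Y)
  logTrunc-∣ₚ p≥3 {n} {x} n≥1 p^n∣px (suc i) =
    ∣ₚ-resp-≃ (ℚᵘ.≃-sym split-last-term)
      (∣ₚ-+ _ _ (logTrunc-∣ₚ p≥3 n≥1 p^n∣px i)
                (log-term-∣ₚ p≥3 n≥1 p^n∣px (signℤ (suc i)) (suc i) (s≤s z≤n)))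
    where
    Y A T : ℚ
    Y = + (p ℕ.* x) ℚ./ 1
    A = logTrunc p x (suc i)
    T = (signℤ (suc i) ℤ.* (+ (p ℕ.* x)) ℤ.^ suc (suc i)) ℚ./ suc (suc i)
    split-last-term : toℚᵘ (A ℚ.+ T ℚ.- Y) ℚᵘ.≃
                      toℚᵘ (A ℚ.- Y) ℚᵘ.+ mkℚᵘ (signℤ (suc i) ℤ.* (+ (p ℕ.* x)) ℤ.^ suc (suc i)) (suc i)
    split-last-term = begin
      toℚᵘ (A ℚ.+ T ℚ.- Y)        ≡⟨ cong toℚᵘ (ℚ.+-assoc A T (ℚ.- Y)) ⟩
      toℚᵘ (A ℚ.+ (T ℚ.- Y))      ≡⟨ cong (λ u → toℚᵘ (A ℚ.+ u)) (ℚ.+-comm T (ℚ.- Y)) ⟩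
      toℚᵘ (A ℚ.+ (ℚ.- Y ℚ.+ T))  ≡⟨ cong toℚᵘ (ℚ.+-assoc A (ℚ.- Y) T) ⟨
      toℚᵘ (A ℚ.- Y ℚ.+ T)        ≈⟨ ℚ.toℚᵘ-homo-+ (A ℚ.- Y) T ⟩
      toℚᵘ (A ℚ.- Y) ℚᵘ.+ toℚᵘ T
        ≈⟨ ℚᵘ.+-congʳ (toℚᵘ (A ℚ.- Y)) (ℚ.toℚᵘ-fromℚᵘ (mkℚᵘ _ (suc i))) ⟩
      toℚᵘ (A ℚ.- Y) ℚᵘ.+ mkℚᵘ (signℤ (suc i) ℤ.* (+ (p ℕ.* x)) ℤ.^ suc (suc i)) (suc i) ∎
      where open ℚᵘ.≃-Reasoning

  isLogMod : 3 ≤ p → ∀ {n x} → 1 ≤ n → p ℕ.^ n ∣ p ℕ.* x → IsLogMod p (2 ℕ.* n) x (+ (p ℕ.* x))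
  isLogMod p≥3 {n@(suc _)} {x} n≥1 p^n∣px =
    ∣ₚ⇒QCongMod {2 ℕ.* n} (logTrunc p x (2 ℕ.* (2 ℕ.* n))) (+ (p ℕ.* x))
      (logTrunc-∣ₚ p≥3 n≥1 p^n∣px (ℕ.pred (2 ℕ.* (2 ℕ.* n))))

-- Powers, roots of unity and finite sums in a commutative ring

module Powers {c ℓ} (R : CommutativeRing c ℓ) where
  open CommutativeRing R
  open import Algebra.Properties.CommutativeSemiring.Exp commutativeSemiring public
  open import Algebra.Properties.CommutativeSemigroup *-commutativeSemigroup using (x∙yz≈xz∙y)
  open import Relation.Binary.Reasoning.Setoid setoid

  pow≡^ : ∀ x n → pow R x n ≡ x ^ n
  pow≡^ x zero    = ≡.refl
  pow≡^ x (suc n) = cong (x *_) (pow≡^ x n)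

  x≈1⇒x^n≈1 : ∀ {x} → x ≈ 1# → ∀ n → x ^ n ≈ 1#
  x≈1⇒x^n≈1 x≈1 zero    = refl
  x≈1⇒x^n≈1 x≈1 (suc n) = trans (*-cong x≈1 (x≈1⇒x^n≈1 x≈1 n)) (*-identityˡ 1#)

  x^N≈1⇒N∣m⇒x^m≈1 : ∀ {x N m} → x ^ N ≈ 1# → N ∣ m → x ^ m ≈ 1#
  x^N≈1⇒N∣m⇒x^m≈1 {x} {N} x^N≈1 (divides k ≡.refl) = begin
    x ^ (k ℕ.* N)  ≡⟨ cong (x ^_) (ℕ.*-comm k N) ⟩
    x ^ (N ℕ.* k)  ≈⟨ ^-assocʳ x N k ⟨
    (x ^ N) ^ k    ≈⟨ x≈1⇒x^n≈1 x^N≈1 k ⟩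
    1#             ∎

  left-inverse-unique : ∀ {a b w} → a * w ≈ 1# → b * w ≈ 1# → a ≈ b
  left-inverse-unique {a} {b} {w} aw≈1 bw≈1 = begin
    a            ≈⟨ *-identityʳ a ⟨
    a * 1#       ≈⟨ *-congˡ bw≈1 ⟨
    a * (b * w)  ≈⟨ x∙yz≈xz∙y a b w ⟩
    a * w * b    ≈⟨ *-congʳ aw≈1 ⟩
    1# * b       ≈⟨ *-identityˡ b ⟩
    b            ∎

  isPrimitiveRoot-^ : ∀ {a M ζ} → 0 < a → IsPrimitiveRoot R (a ℕ.* M) ζ →
                      IsPrimitiveRoot R M (ζ ^ a)
  isPrimitiveRoot-^ {a} {M} {ζ} a>0 (ζ^aM≈1 , ζ-minimal) = ζ^a^M≈1 , ζ^a-minimal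
    where
    pow-^ : ∀ d → pow R (ζ ^ a) d ≈ pow R ζ (a ℕ.* d)
    pow-^ d = begin
      pow R (ζ ^ a) d    ≡⟨ pow≡^ (ζ ^ a) d ⟩
      (ζ ^ a) ^ d        ≈⟨ ^-assocʳ ζ a d ⟩
      ζ ^ (a ℕ.* d)      ≡⟨ pow≡^ ζ (a ℕ.* d) ⟨
      pow R ζ (a ℕ.* d)  ∎
    ζ^a^M≈1 : pow R (ζ ^ a) M ≈ 1#
    ζ^a^M≈1 = trans (pow-^ M) ζ^aM≈1
    ζ^a-minimal : ∀ d → 0 < d → d < M → ¬ pow R (ζ ^ a) d ≈ 1#
    ζ^a-minimal d d>0 d<M ζ^ad≈1 = ζ-minimal (a ℕ.* d) (ℕ.*-mono-≤ a>0 d>0)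
      (ℕ.*-monoʳ-< a {{ℕ.>-nonZero a>0}} d<M) (trans (sym (pow-^ d)) ζ^ad≈1)

  -- zpow N ζ -[1+ a ] is ζ^{(N − 1)(a + 1)}, and (N − 1)(a + 1) ≡ −(a + 1) (mod N).
  zpow≈^ : ∀ {N} ζ → 1 ≤ N → ∀ i → ∃ λ e → zpow R N ζ i ≈ ζ ^ e × (+ N) ℤ.∣ (+ e ℤ.- i)
  zpow≈^ ζ _ (+ a) = a , reflexive (pow≡^ ζ a) , ℤ.divides (+ 0) (ℤ.+-inverseʳ (+ a))
  zpow≈^ {suc N} ζ _ -[1+ a ] =
    N ℕ.* suc a , ζ^-N-1≈ζ^[N*[1+a]] , ℤ.divides (+ suc a) (cong +_ (count N a))
    where
    ζ^-N-1≈ζ^[N*[1+a]] : pow R (pow R ζ N) (suc a) ≈ ζ ^ (N ℕ.* suc a)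
    ζ^-N-1≈ζ^[N*[1+a]] = begin
      pow R (pow R ζ N) (suc a)  ≡⟨ ≡.trans (pow≡^ (pow R ζ N) (suc a)) (cong (_^ suc a) (pow≡^ ζ N)) ⟩
      (ζ ^ N) ^ suc a            ≈⟨ ^-assocʳ ζ N (suc a) ⟩
      ζ ^ (N ℕ.* suc a)          ∎
    count : ∀ N a → N ℕ.* suc a ℕ.+ suc a ≡ suc a ℕ.* suc N
    count = ℕ-Solver.solve-∀

  zpow-cancel : ∀ {N ζ} → pow R ζ N ≈ 1# → 1 ≤ N → ∀ i v → (+ N) ℤ.∣ (i ℤ.+ + v) →
                zpow R N ζ i * ζ ^ v ≈ 1#
  zpow-cancel {N} {ζ} ζ^N≈1 N≥1 i v N∣i+v with zpow≈^ ζ N≥1 i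
  ... | e , zpow≈ζ^e , N∣e-i = begin
    zpow R N ζ i * ζ ^ v  ≈⟨ *-congʳ zpow≈ζ^e ⟩
    ζ ^ e * ζ ^ v         ≈⟨ ^-homo-* ζ e v ⟨
    ζ ^ (e ℕ.+ v)         ≈⟨ x^N≈1⇒N∣m⇒x^m≈1 (trans (reflexive (≡.sym (pow≡^ ζ N))) ζ^N≈1) N∣e+v ⟩
    1#                    ∎
    where
    telescope : ∀ e i v → (e ℤ.- i) ℤ.+ (i ℤ.+ v) ≡ e ℤ.+ v
    telescope = ℤ-Solver.solve-∀
    N∣e+v : N ∣ e ℕ.+ v
    N∣e+v = ℤ.∣⇒∣ᵤ (subst ((+ N) ℤ.∣_) (≡.trans (telescope (+ e) i (+ v)) (≡.sym (ℤ.pos-+ e v)))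
                          (ℤ.∣m∣n⇒∣m+n N∣e-i N∣i+v))

module FiniteSums {c ℓ} (R : CommutativeRing c ℓ) where
  open CommutativeRing R
  open Powers R
  open import Algebra.Properties.CommutativeSemigroup +-commutativeSemigroup using (interchange; xy∙z≈xz∙y)
  open import Algebra.Properties.AbelianGroup +-abelianGroup using (xyx⁻¹≈y; x∙y⁻¹≈ε⇒x≈y)
  open import Algebra.Properties.Ring ring using (x[y-z]≈xy-xz)
  open import Relation.Binary.Reasoning.Setoid setoid

  sumR-cong : ∀ m {f g} → (∀ i → i < m → f i ≈ g i) → sumR R m f ≈ sumR R m g
  sumR-cong zero    f≈g = refl
  sumR-cong (suc m) f≈g = +-cong (sumR-cong m λ i i<m → f≈g i (ℕ.m<n⇒m<1+n i<m)) (f≈g m ℕ.≤-refl)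

  sumR-zero : ∀ m {f} → (∀ i → i < m → f i ≈ 0#) → sumR R m f ≈ 0#
  sumR-zero zero    f≈0 = refl
  sumR-zero (suc m) f≈0 =
    trans (+-cong (sumR-zero m λ i i<m → f≈0 i (ℕ.m<n⇒m<1+n i<m)) (f≈0 m ℕ.≤-refl)) (+-identityˡ 0#)

  sumR-+ : ∀ m f g → sumR R m (λ i → f i + g i) ≈ sumR R m f + sumR R m g
  sumR-+ zero    f g = sym (+-identityˡ 0#)
  sumR-+ (suc m) f g = trans (+-congʳ (sumR-+ m f g)) (interchange _ _ _ _)

  sumR-*ˡ : ∀ m a f → sumR R m (λ i → a * f i) ≈ a * sumR R m f
  sumR-*ˡ zero    a f = sym (zeroʳ a)
  sumR-*ˡ (suc m) a f = trans (+-congʳ (sumR-*ˡ m a f)) (sym (distribˡ a _ _))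

  sumR-++ : ∀ a b f → sumR R (a ℕ.+ b) f ≈ sumR R a f + sumR R b (λ i → f (a ℕ.+ i))
  sumR-++ a zero    f = trans (reflexive (cong (λ n → sumR R n f) (ℕ.+-identityʳ a))) (sym (+-identityʳ _))
  sumR-++ a (suc b) f = begin
    sumR R (a ℕ.+ suc b) f                                     ≡⟨ cong (λ n → sumR R n f) (ℕ.+-suc a b) ⟩
    sumR R (a ℕ.+ b) f + f (a ℕ.+ b)                           ≈⟨ +-congʳ (sumR-++ a b f) ⟩
    sumR R a f + sumR R b (λ i → f (a ℕ.+ i)) + f (a ℕ.+ b)    ≈⟨ +-assoc _ _ _ ⟩
    sumR R a f + (sumR R b (λ i → f (a ℕ.+ i)) + f (a ℕ.+ b))  ∎

  sumR-digits : ∀ A B f → sumR R (A ℕ.* B) f ≈ sumR R A (λ x → sumR R B (λ y → f (x ℕ.+ A ℕ.* y)))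
  sumR-digits A zero    f = begin
    sumR R (A ℕ.* 0) f   ≡⟨ cong (λ n → sumR R n f) (ℕ.*-zeroʳ A) ⟩
    0#                   ≈⟨ sumR-zero A (λ _ _ → refl) ⟨
    sumR R A (λ _ → 0#)  ∎
  sumR-digits A (suc B) f = begin
    sumR R (A ℕ.* suc B) f
      ≡⟨ cong (λ n → sumR R n f) (≡.trans (ℕ.*-suc A B) (ℕ.+-comm A (A ℕ.* B))) ⟩
    sumR R (A ℕ.* B ℕ.+ A) f
      ≈⟨ sumR-++ (A ℕ.* B) A f ⟩
    sumR R (A ℕ.* B) f + sumR R A (λ x → f (A ℕ.* B ℕ.+ x))
      ≈⟨ +-cong (sumR-digits A B f) (sumR-cong A λ x _ → reflexive (cong f (ℕ.+-comm (A ℕ.* B) x))) ⟩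
    sumR R A (λ x → sumR R B (λ y → f (x ℕ.+ A ℕ.* y))) + sumR R A (λ x → f (x ℕ.+ A ℕ.* B))
      ≈⟨ sumR-+ A _ _ ⟨
    sumR R A (λ x → sumR R (suc B) (λ y → f (x ℕ.+ A ℕ.* y)))
      ∎

  sumR-1# : ∀ m → sumR R m (λ _ → 1#) ≈ natR R m
  sumR-1# zero    = refl
  sumR-1# (suc m) = trans (+-comm _ 1#) (+-congˡ (sumR-1# m))

  sumR-concentrated : ∀ {m k f} → k < m → (∀ i → i < m → i ≢ k → f i ≈ 0#) → sumR R m f ≈ f k
  sumR-concentrated {suc m} {k} {f} k<1+m f≈0 with k ℕ.≟ m
  ... | yes ≡.refl =
    trans (+-congʳ (sumR-zero m λ i i<k → f≈0 i (ℕ.m<n⇒m<1+n i<k) (ℕ.<⇒≢ i<k))) (+-identityˡ (f k))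
  ... | no k≢m =
    trans (+-cong (sumR-concentrated (ℕ.≤∧≢⇒< (ℕ.≤-pred k<1+m) k≢m)
                                     λ i i<m → f≈0 i (ℕ.m<n⇒m<1+n i<m))
                  (f≈0 m ℕ.≤-refl (k≢m ∘ ≡.sym)))
          (+-identityʳ (f k))

  geometric-sum : ∀ θ m → sumR R m (θ ^_) * (θ - 1#) ≈ θ ^ m - 1#
  geometric-sum θ zero    = trans (zeroˡ _) (sym (-‿inverseʳ 1#))
  geometric-sum θ (suc m) = begin
    (S + θ ^ m) * (θ - 1#)                   ≈⟨ distribʳ _ _ _ ⟩
    S * (θ - 1#) + θ ^ m * (θ - 1#)          ≈⟨ +-cong (geometric-sum θ m) (x[y-z]≈xy-xz _ _ _) ⟩
    (θ ^ m - 1#) + (θ ^ m * θ - θ ^ m * 1#)  ≈⟨ +-congˡ (+-cong (*-comm _ _) (-‿cong (*-identityʳ _))) ⟩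
    (θ ^ m - 1#) + (θ * θ ^ m - θ ^ m)       ≈⟨ telescope (θ ^ m) (θ * θ ^ m) ⟩
    θ * θ ^ m - 1#                           ∎
    where
    S : Carrier
    S = sumR R m (θ ^_)
    telescope : ∀ a b → (a - 1#) + (b - a) ≈ b - 1#
    telescope a b = trans (xy∙z≈xz∙y a (- 1#) (b - a))
                          (+-congʳ (trans (sym (+-assoc a b (- a))) (xyx⁻¹≈y a b)))

  geometric-sum-trivial : ∀ {θ} → θ ≈ 1# → ∀ m → sumR R m (θ ^_) ≈ natR R m
  geometric-sum-trivial θ≈1 m = trans (sumR-cong m λ i _ → x≈1⇒x^n≈1 θ≈1 i) (sumR-1# m)

  geometric-sum-vanishes : IsDomain R → ∀ {θ} m → θ ^ m ≈ 1# → ¬ θ ≈ 1# → sumR R m (θ ^_) ≈ 0#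
  geometric-sum-vanishes (_ , no-zero-divisors) {θ} m θ^m≈1 θ≉1
    with no-zero-divisors _ _ (trans (geometric-sum θ m) (trans (+-congʳ θ^m≈1) (-‿inverseʳ 1#)))
  ... | inj₁ sum≈0 = sum≈0
  ... | inj₂ θ-1≈0 = ⊥-elim (θ≉1 (x∙y⁻¹≈ε⇒x≈y θ 1# θ-1≈0))

-- Twisted Gauss sums modulo K²

record InverseMod (K x : ℕ) : Set where
  constructor inverseMod
  field
    u w     : ℕ
    xu≡1+Kw : x ℕ.* u ≡ 1 ℕ.+ K ℕ.* w

coprime⇒inverse : ∀ {x K} → 2 ≤ K → Coprime x K → InverseMod K x
coprime⇒inverse {K = 1} (s≤s ()) _
coprime⇒inverse {x} {K@(suc (suc k))} _ x∼K with coprime-Bézout x∼K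
... | Bézout.+- a b 1+bK≡ax =
  inverseMod a b (≡.trans (ℕ.*-comm x a) (≡.trans (≡.sym 1+bK≡ax) (cong suc (ℕ.*-comm b K))))
-- 1 + a x = b K gives x · a(K − 1) = 1 + K (b (K − 1) − 1).
... | Bézout.-+ a (suc b) 1+ax≡bK =
  inverseMod (a ℕ.* suc k) (k ℕ.+ b ℕ.* suc k) (ℕ.+-cancelʳ-≡ (suc k) _ _ (begin
    x ℕ.* (a ℕ.* suc k) ℕ.+ suc k              ≡⟨ ℕ-Solver.solve (x ∷ a ∷ k ∷ []) ⟩
    (1 ℕ.+ a ℕ.* x) ℕ.* suc k                  ≡⟨ cong (ℕ._* suc k) 1+ax≡bK ⟩
    suc b ℕ.* K ℕ.* suc k                      ≡⟨ ℕ-Solver.solve (b ∷ k ∷ []) ⟩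
    1 ℕ.+ K ℕ.* (k ℕ.+ b ℕ.* suc k) ℕ.+ suc k  ∎))
  where open ≡.≡-Reasoning

x+Ky+K²yw≡x[1+Kuy] : ∀ {x u w K} → x ℕ.* u ≡ 1 ℕ.+ K ℕ.* w →
                     ∀ y → x ℕ.+ K ℕ.* y ℕ.+ K ℕ.* K ℕ.* (y ℕ.* w) ≡ x ℕ.* (1 ℕ.+ K ℕ.* (u ℕ.* y))
x+Ky+K²yw≡x[1+Kuy] {x} {u} {w} {K} xu≡1+Kw y = ≡.sym (begin
  x ℕ.* (1 ℕ.+ K ℕ.* (u ℕ.* y))            ≡⟨ ℕ-Solver.solve (x ∷ K ∷ u ∷ y ∷ []) ⟩
  x ℕ.+ K ℕ.* y ℕ.* (x ℕ.* u)              ≡⟨ cong (λ n → x ℕ.+ K ℕ.* y ℕ.* n) xu≡1+Kw ⟩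
  x ℕ.+ K ℕ.* y ℕ.* (1 ℕ.+ K ℕ.* w)        ≡⟨ ℕ-Solver.solve (x ∷ K ∷ y ∷ w ∷ []) ⟩
  x ℕ.+ K ℕ.* y ℕ.+ K ℕ.* K ℕ.* (y ℕ.* w)  ∎)
  where open ≡.≡-Reasoning

module _ {c ℓ} {R : CommutativeRing c ℓ} where
  open CommutativeRing R

  periodic-multiple : ∀ {q χ} → IsDirichletChar R q χ → ∀ a k → χ (a ℕ.+ q ℕ.* k) ≈ χ a
  periodic-multiple {q} {χ} χ-char a zero    =
    reflexive (cong χ (≡.trans (cong (a ℕ.+_) (ℕ.*-zeroʳ q)) (ℕ.+-identityʳ a)))
  periodic-multiple {q} {χ} χ-char a (suc k) =
    trans (reflexive (cong χ (shift a q k)))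
          (trans (IsDirichletChar.periodic χ-char _) (periodic-multiple χ-char a k))
    where
    shift : ∀ a q k → a ℕ.+ q ℕ.* suc k ≡ a ℕ.+ q ℕ.* k ℕ.+ q
    shift = ℕ-Solver.solve-∀

module _ {c ℓ} (R : CommutativeRing c ℓ) where
  open CommutativeRing R
  open Powers R
  open FiniteSums R
  open IsDirichletChar
  open import Algebra.Properties.CommutativeSemigroup *-commutativeSemigroup using (interchange; xy∙z≈xz∙y)
  open import Relation.Binary.Reasoning.Setoid setoid

  -- z plays the role of e_{K²}(1), so that ω = e_K(1) and ι = ω⁻¹; the last hypothesis
  -- says χ(1 + K m) = e_K(−m).
  module TwistedGaussSum
    (domain : IsDomain R) {K : ℕ} (K≥2 : 2 ≤ K)
    {z : Carrier} (ω-primitive : IsPrimitiveRoot R K (z ^ K))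
    {χ ψ : ℕ → Carrier} (χ-char : IsDirichletChar R (K ℕ.* K) χ) (ψ-char : IsDirichletChar R K ψ)
    (χ[1+Km]ω^m≈1 : ∀ m → χ (1 ℕ.+ K ℕ.* m) * (z ^ K) ^ m ≈ 1#)
    where

    ω ι : Carrier
    ω = z ^ K
    ι = ω ^ (K ℕ.∸ 1)

    ω^K≈1 : ω ^ K ≈ 1#
    ω^K≈1 = trans (reflexive (≡.sym (pow≡^ ω K))) (proj₁ ω-primitive)

    ιω≈1 : ι * ω ≈ 1#
    ιω≈1 = trans (*-comm ι ω) (trans (reflexive (cong (ω ^_) 1+[K∸1]≡K)) ω^K≈1)
      where
      1+[K∸1]≡K : suc (K ℕ.∸ 1) ≡ K
      1+[K∸1]≡K = ℕ.suc-pred K {{ℕ.>-nonZero (ℕ.≤-trans (s≤s z≤n) K≥2)}}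

    ι^K≈1 : ι ^ K ≈ 1#
    ι^K≈1 = trans (^-assocʳ ω (K ℕ.∸ 1) K) (x^N≈1⇒N∣m⇒x^m≈1 ω^K≈1 (n∣m*n (K ℕ.∸ 1)))

    χ[1+Km]≈ι^m : ∀ m → χ (1 ℕ.+ K ℕ.* m) ≈ ι ^ m
    χ[1+Km]≈ι^m m = left-inverse-unique (χ[1+Km]ω^m≈1 m)
                                        (trans (sym (^-distrib-* ι ω m)) (x≈1⇒x^n≈1 ιω≈1 m))

    summand : ℕ → Carrier
    summand t = χ t * ψ t * z ^ t

    residue-sum : ℕ → Carrier
    residue-sum x = sumR R K (λ y → summand (x ℕ.+ K ℕ.* y))

    residue-sum-non-coprime : ∀ {x} → ¬ Coprime x K → residue-sum x ≈ 0#
    residue-sum-non-coprime {x} x≁K = sumR-zero K λ y _ →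
      trans (*-congʳ (trans (*-congʳ (vanish χ-char _ (x≁K ∘ coprime-digit y))) (zeroˡ _))) (zeroˡ _)
      where
      coprime-digit : ∀ y → Coprime (x ℕ.+ K ℕ.* y) (K ℕ.* K) → Coprime x K
      coprime-digit y c (d∣x , d∣K) = c (∣m∣n⇒∣m+n d∣x (∣m⇒∣m*n y d∣K) , ∣m⇒∣m*n K d∣K)

    module _ {x : ℕ} (x⁻¹ : InverseMod K x) where
      open InverseMod x⁻¹

      θ : Carrier
      θ = ι ^ u * ω

      χ-digit : ∀ y → χ (x ℕ.+ K ℕ.* y) ≈ χ x * (ι ^ u) ^ y
      χ-digit y = begin
        χ (x ℕ.+ K ℕ.* y)
          ≈⟨ periodic-multiple χ-char (x ℕ.+ K ℕ.* y) (y ℕ.* w) ⟨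
        χ (x ℕ.+ K ℕ.* y ℕ.+ K ℕ.* K ℕ.* (y ℕ.* w))
          ≡⟨ cong χ (x+Ky+K²yw≡x[1+Kuy] {x} {u} {w} {K} xu≡1+Kw y) ⟩
        χ (x ℕ.* (1 ℕ.+ K ℕ.* (u ℕ.* y)))
          ≈⟨ multiplicative χ-char x _ ⟩
        χ x * χ (1 ℕ.+ K ℕ.* (u ℕ.* y))
          ≈⟨ *-congˡ (χ[1+Km]≈ι^m (u ℕ.* y)) ⟩
        χ x * ι ^ (u ℕ.* y)
          ≈⟨ *-congˡ (^-assocʳ ι u y) ⟨
        χ x * (ι ^ u) ^ y
          ∎

      z-digit : ∀ y → z ^ (x ℕ.+ K ℕ.* y) ≈ z ^ x * ω ^ y
      z-digit y = trans (^-homo-* z x (K ℕ.* y)) (*-congˡ (sym (^-assocʳ z K y)))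

      summand-digit : ∀ y → summand (x ℕ.+ K ℕ.* y) ≈ summand x * θ ^ y
      summand-digit y = begin
        summand (x ℕ.+ K ℕ.* y)
          ≈⟨ *-cong (*-cong (χ-digit y) (periodic-multiple ψ-char x y)) (z-digit y) ⟩
        χ x * (ι ^ u) ^ y * ψ x * (z ^ x * ω ^ y)
          ≈⟨ regroup (χ x) _ (ψ x) _ _ ⟩
        summand x * ((ι ^ u) ^ y * ω ^ y)
          ≈⟨ *-congˡ (^-distrib-* (ι ^ u) ω y) ⟨
        summand x * θ ^ y
          ∎
        where
        regroup : ∀ a b c d e → a * b * c * (d * e) ≈ a * c * d * (b * e)
        regroup a b c d e = trans (*-congʳ (xy∙z≈xz∙y a b c)) (interchange (a * c) b d e)

      residue-sum-geometric : residue-sum x ≈ summand x * sumR R K (θ ^_)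
      residue-sum-geometric =
        trans (sumR-cong K λ y _ → summand-digit y) (sumR-*ˡ K (summand x) (θ ^_))

      θ^K≈1 : θ ^ K ≈ 1#
      θ^K≈1 = begin
        (ι ^ u * ω) ^ K      ≈⟨ ^-distrib-* (ι ^ u) ω K ⟩
        (ι ^ u) ^ K * ω ^ K  ≈⟨ *-cong (trans (^-assocʳ ι u K) (x^N≈1⇒N∣m⇒x^m≈1 ι^K≈1 (n∣m*n u)))
                                        ω^K≈1 ⟩
        1# * 1#              ≈⟨ *-identityˡ 1# ⟩
        1#                   ∎

      θ^x≈ιω^x : θ ^ x ≈ ι * ω ^ x
      θ^x≈ιω^x = begin
        (ι ^ u * ω) ^ x            ≈⟨ ^-distrib-* (ι ^ u) ω x ⟩
        (ι ^ u) ^ x * ω ^ x        ≈⟨ *-congʳ (^-assocʳ ι u x) ⟩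
        ι ^ (u ℕ.* x) * ω ^ x      ≡⟨ cong (λ n → ι ^ n * ω ^ x) (≡.trans (ℕ.*-comm u x) xu≡1+Kw) ⟩
        ι * ι ^ (K ℕ.* w) * ω ^ x  ≈⟨ *-congʳ (*-congˡ (x^N≈1⇒N∣m⇒x^m≈1 ι^K≈1 (m∣m*n {K} w))) ⟩
        ι * 1# * ω ^ x             ≈⟨ *-congʳ (*-identityʳ ι) ⟩
        ι * ω ^ x                  ∎

    θ≉1 : ∀ {x} (x⁻¹ : InverseMod K x) → x < K → x ≢ 1 → ¬ θ x⁻¹ ≈ 1#
    θ≉1 {suc zero}      _   _     x≢1 _   = x≢1 ≡.refl
    θ≉1 {suc x@(suc _)} x⁻¹ 1+x<K _   θ≈1 =
      proj₂ ω-primitive x (s≤s z≤n) (ℕ.<-trans (ℕ.n<1+n x) 1+x<K) (begin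
        pow R ω x      ≡⟨ pow≡^ ω x ⟩
        ω ^ x          ≈⟨ *-identityˡ (ω ^ x) ⟨
        1# * ω ^ x     ≈⟨ *-congʳ ιω≈1 ⟨
        ι * ω * ω ^ x  ≈⟨ *-assoc ι ω (ω ^ x) ⟩
        ι * ω ^ suc x  ≈⟨ θ^x≈ιω^x x⁻¹ ⟨
        θ x⁻¹ ^ suc x  ≈⟨ x≈1⇒x^n≈1 θ≈1 (suc x) ⟩
        1#             ∎)

    residue-sum-vanishes : ∀ {x} → x < K → x ≢ 1 → residue-sum x ≈ 0#
    residue-sum-vanishes {x} x<K x≢1 with coprime? x K
    ... | no x≁K = residue-sum-non-coprime x≁K
    ... | yes x∼K with coprime⇒inverse K≥2 x∼K
    ... | x⁻¹ = begin
      residue-sum x                    ≈⟨ residue-sum-geometric x⁻¹ ⟩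
      summand x * sumR R K (θ x⁻¹ ^_)  ≈⟨ *-congˡ (geometric-sum-vanishes domain K (θ^K≈1 x⁻¹)
                                                                          (θ≉1 x⁻¹ x<K x≢1)) ⟩
      summand x * 0#                   ≈⟨ zeroʳ (summand x) ⟩
      0#                               ∎

    residue-sum-1 : residue-sum 1 ≈ natR R K * z
    residue-sum-1 = begin
      residue-sum 1                    ≈⟨ residue-sum-geometric 1⁻¹ ⟩
      summand 1 * sumR R K (θ 1⁻¹ ^_)  ≈⟨ *-cong summand-1≈z (geometric-sum-trivial θ≈1 K) ⟩
      z * natR R K                     ≈⟨ *-comm z (natR R K) ⟩
      natR R K * z                     ∎
      where
      1⁻¹ : InverseMod K 1
      1⁻¹ = inverseMod 1 0 (cong suc (≡.sym (ℕ.*-zeroʳ K)))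
      θ≈1 : θ 1⁻¹ ≈ 1#
      θ≈1 = trans (*-congʳ (*-identityʳ ι)) ιω≈1
      summand-1≈z : summand 1 ≈ z
      summand-1≈z = trans (*-congʳ (trans (*-cong (one χ-char) (one ψ-char)) (*-identityˡ 1#)))
                          (trans (*-identityˡ (z * 1#)) (*-identityʳ z))

    twisted-gauss-sum : sumR R (K ℕ.* K) (λ t → χ t * ψ t * z ^ t) ≈ natR R K * z
    twisted-gauss-sum = begin
      sumR R (K ℕ.* K) summand  ≈⟨ sumR-digits K K summand ⟩
      sumR R K residue-sum      ≈⟨ sumR-concentrated K≥2 (λ _ → residue-sum-vanishes) ⟩
      residue-sum 1             ≈⟨ residue-sum-1 ⟩
      natR R K * z              ∎

-- The case K = p^n

odd-prime≥3 : ∀ {p} → Prime p → p ≢ 2 → 3 ≤ p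
odd-prime≥3 {p} pp p≢2 = ℕ.≤∧≢⇒< (ℕ.nonTrivial⇒n>1 p {{prime⇒nonTrivial pp}}) (p≢2 ∘ ≡.sym)

2≤p^n : ∀ {p n} → 2 ≤ p → 1 ≤ n → 2 ≤ p ℕ.^ n
2≤p^n {p} {suc n} p≥2 _ = ℕ.≤-trans p≥2 (ℕ.m≤m*n p (p ℕ.^ n) {{p^n≢0}})
  where
  p^n≢0 : ℕ.NonZero (p ℕ.^ n)
  p^n≢0 = ℕ.m^n≢0 p n {{ℕ.>-nonZero (ℕ.≤-trans (s≤s z≤n) p≥2)}}

p^n*p^n≡p^[2n] : ∀ p n → p ℕ.^ n ℕ.* p ℕ.^ n ≡ p ℕ.^ (2 ℕ.* n)
p^n*p^n≡p^[2n] p n =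
  ≡.trans (≡.sym (ℕ.^-distribˡ-+-* p n n)) (cong (λ k → p ℕ.^ (n ℕ.+ k)) (≡.sym (ℕ.+-identityʳ n)))

K∣l+1⇒K²P₁∣P₁Km[l+1] : ∀ P₁ {K l} m → + K ℤ.∣ l ℤ.+ ℤ.1ℤ →
                       + K ℤ.* + K ℤ.* + P₁ ℤ.∣ + P₁ ℤ.* (l ℤ.* + (K ℕ.* m)) ℤ.+ + (P₁ ℕ.* (K ℕ.* m))
K∣l+1⇒K²P₁∣P₁Km[l+1] P₁ {K} {l} m (ℤ.divides q l+1≡qK) = ℤ.divides (q ℤ.* + m) (begin
  + P₁ ℤ.* (l ℤ.* + (K ℕ.* m)) ℤ.+ + (P₁ ℕ.* (K ℕ.* m))
    ≡⟨ cong (λ a → + P₁ ℤ.* (l ℤ.* + (K ℕ.* m)) ℤ.+ a) (ℤ.pos-* P₁ (K ℕ.* m)) ⟩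
  + P₁ ℤ.* (l ℤ.* + (K ℕ.* m)) ℤ.+ + P₁ ℤ.* + (K ℕ.* m)
    ≡⟨ factor-l+1 (+ P₁) l (+ (K ℕ.* m)) ⟩
  + P₁ ℤ.* + (K ℕ.* m) ℤ.* (l ℤ.+ ℤ.1ℤ)
    ≡⟨ cong₂ (λ a b → + P₁ ℤ.* a ℤ.* b) (ℤ.pos-* K m) l+1≡qK ⟩
  + P₁ ℤ.* (+ K ℤ.* + m) ℤ.* (q ℤ.* + K)
    ≡⟨ regroup (+ P₁) (+ K) (+ m) q ⟩
  q ℤ.* + m ℤ.* (+ K ℤ.* + K ℤ.* + P₁)
    ∎)
  where
  open ≡.≡-Reasoning
  factor-l+1 : ∀ P l y → P ℤ.* (l ℤ.* y) ℤ.+ P ℤ.* y ≡ P ℤ.* y ℤ.* (l ℤ.+ ℤ.1ℤ)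
  factor-l+1 = ℤ-Solver.solve-∀
  regroup : ∀ P K m q → P ℤ.* (K ℤ.* m) ℤ.* (q ℤ.* K) ≡ q ℤ.* m ℤ.* (K ℤ.* K ℤ.* P)
  regroup = ℤ-Solver.solve-∀

module _ {c ℓ} (R : CommutativeRing c ℓ) where
  open CommutativeRing R
  open Powers R
  open FiniteSums R
  open import Relation.Binary.Reasoning.Setoid setoid

  eP≈^ : ∀ p k ζ t → eP R p k ζ (+ t) ≈ (ζ ^ (p ℕ.∸ 1)) ^ t
  eP≈^ p k ζ t = begin
    zpow R (ModulusN R p k) ζ (+ (p ℕ.∸ 1) ℤ.* + t)
      ≡⟨ cong (zpow R (ModulusN R p k) ζ) (ℤ.pos-* (p ℕ.∸ 1) t) ⟨
    pow R ζ ((p ℕ.∸ 1) ℕ.* t)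
      ≡⟨ pow≡^ ζ ((p ℕ.∸ 1) ℕ.* t) ⟩
    ζ ^ ((p ℕ.∸ 1) ℕ.* t)
      ≈⟨ ^-assocʳ ζ (p ℕ.∸ 1) t ⟨
    (ζ ^ (p ℕ.∸ 1)) ^ t
      ∎

  gauss≈sumR : ∀ p k ζ f → gauss R p k ζ f ≈ sumR R (p ℕ.^ k) (λ t → f t * (ζ ^ (p ℕ.∸ 1)) ^ t)
  gauss≈sumR p k ζ f = sumR-cong (p ℕ.^ k) λ t _ → *-congˡ (eP≈^ p k ζ t)

  isPrimitiveRoot-e[1/p^n] : ∀ {p n ζ} → 2 ≤ p → IsPrimitiveRoot R (ModulusN R p (2 ℕ.* n)) ζ →
                             IsPrimitiveRoot R (p ℕ.^ n) ((ζ ^ (p ℕ.∸ 1)) ^ p ℕ.^ n)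
  isPrimitiveRoot-e[1/p^n] {p} {n} {ζ} p≥2 ζ-primitive =
    isPrimitiveRoot-^ K>0 (isPrimitiveRoot-^ (ℕ.∸-monoˡ-≤ 1 p≥2)
      (subst (λ N → IsPrimitiveRoot R N ζ) N≡P₁*[K*K] ζ-primitive))
    where
    K : ℕ
    K = p ℕ.^ n
    K>0 : 0 < K
    K>0 = ℕ.m^n>0 p {{ℕ.>-nonZero (ℕ.≤-trans (s≤s z≤n) p≥2)}} n
    N≡P₁*[K*K] : ModulusN R p (2 ℕ.* n) ≡ (p ℕ.∸ 1) ℕ.* (K ℕ.* K)
    N≡P₁*[K*K] = ≡.trans (ℕ.*-comm (p ℕ.^ (2 ℕ.* n)) (p ℕ.∸ 1))
                         (cong ((p ℕ.∸ 1) ℕ.*_) (≡.sym (p^n*p^n≡p^[2n] p n)))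

  -- ℓ ≡ −1 (mod p^n) makes ℓ · p^n m ≡ −p^n m (mod p^{2n}).
  χ[1+p^n·m]·ω^m≈1 : ∀ {p n ζ χ} → Prime p → 3 ≤ p → 1 ≤ n →
                     pow R ζ (ModulusN R p (2 ℕ.* n)) ≈ 1# → EllCondition R p (2 ℕ.* n) n ζ χ →
                     ∀ m → χ (1 ℕ.+ p ℕ.^ n ℕ.* m) * ((ζ ^ (p ℕ.∸ 1)) ^ p ℕ.^ n) ^ m ≈ 1#
  χ[1+p^n·m]·ω^m≈1 {p} {n@(suc n′)} {ζ} {χ} pp p≥3 n≥1 ζ^N≈1 (l , K∣l+1 , χ≈e[l·log]) m = begin
    χ (1 ℕ.+ K ℕ.* m) * ((ζ ^ P₁) ^ K) ^ m
      ≈⟨ *-cong (reflexive (cong (λ a → χ (1 ℕ.+ a)) (≡.sym px≡Km))) ω^m≈ζ^v ⟩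
    χ (1 ℕ.+ p ℕ.* x) * ζ ^ v
      ≈⟨ *-congʳ (χ≈e[l·log] x (+ (p ℕ.* x)) (LocalDivisibility.isLogMod pp p≥3 n≥1 p^n∣px)) ⟩
    eP R p (2 ℕ.* n) ζ (l ℤ.* + (p ℕ.* x)) * ζ ^ v
      ≈⟨ zpow-cancel {N} {ζ} ζ^N≈1 N≥1 (+ P₁ ℤ.* (l ℤ.* + (p ℕ.* x))) v N∣exponent-sum ⟩
    1#
      ∎
    where
    K P₁ N x v : ℕ
    K  = p ℕ.^ n
    P₁ = p ℕ.∸ 1
    N  = ModulusN R p (2 ℕ.* n)
    x  = p ℕ.^ n′ ℕ.* m
    v  = P₁ ℕ.* (p ℕ.* x)
    px≡Km : p ℕ.* x ≡ K ℕ.* m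
    px≡Km = ≡.sym (ℕ.*-assoc p (p ℕ.^ n′) m)
    p^n∣px : K ∣ p ℕ.* x
    p^n∣px = divides m (≡.trans px≡Km (ℕ.*-comm K m))
    ω^m≈ζ^v : ((ζ ^ P₁) ^ K) ^ m ≈ ζ ^ v
    ω^m≈ζ^v = trans (^-assocʳ (ζ ^ P₁) K m) (trans (^-assocʳ ζ P₁ (K ℕ.* m))
                (reflexive (cong (λ a → ζ ^ (P₁ ℕ.* a)) (≡.sym px≡Km))))
    N≥1 : 1 ≤ N
    N≥1 = ℕ.*-mono-≤ (ℕ.m^n>0 p {{ℕ.>-nonZero (ℕ.≤-trans (s≤s z≤n) p≥3)}} (2 ℕ.* n))
                     (ℕ.∸-monoˡ-≤ 1 (ℕ.≤-trans (s≤s (s≤s z≤n)) p≥3))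
    N≡K*K*P₁ : + N ≡ + K ℤ.* + K ℤ.* + P₁
    N≡K*K*P₁ = ≡.trans (cong (λ a → + (a ℕ.* P₁)) (≡.sym (p^n*p^n≡p^[2n] p n)))
                       (≡.trans (ℤ.pos-* (K ℕ.* K) P₁) (cong (ℤ._* + P₁) (ℤ.pos-* K K)))
    N∣exponent-sum : + N ℤ.∣ + P₁ ℤ.* (l ℤ.* + (p ℕ.* x)) ℤ.+ + v
    N∣exponent-sum = subst₂ ℤ._∣_ (≡.sym N≡K*K*P₁)
      (cong (λ a → + P₁ ℤ.* (l ℤ.* + a) ℤ.+ + (P₁ ℕ.* a)) (≡.sym px≡Km))
      (K∣l+1⇒K²P₁∣P₁Km[l+1] P₁ {K} {l} m (ℤ.∣ᵤ⇒∣ {+ K} {l ℤ.+ ℤ.1ℤ} K∣l+1))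

open import Level using (Level)
open import Data.Nat using (_*_; _^_)

corollary2p5 : {c ℓ : Level} (R : CommutativeRing c ℓ) →
  IsDomain R → CharZero R →
  (p n : ℕ) → Prime p → p ≢ 2 → 1 ≤ n →
  (ζ : CommutativeRing.Carrier R) → IsPrimitiveRoot R (ModulusN R p (2 * n)) ζ →
  (χ : ℕ → CommutativeRing.Carrier R) →
  HasConductor R (p ^ (2 * n)) χ →
  EllCondition R p (2 * n) n ζ χ →
  (ψ′ : ℕ → CommutativeRing.Carrier R) → IsDirichletChar R (p ^ n) ψ′ →
  CommutativeRing._≈_ R
    (gauss R p (2 * n) ζ (λ t → CommutativeRing._*_ R (χ t) (ψ′ t)))
    (CommutativeRing._*_ R (natR R (p ^ n)) (eP R p (2 * n) ζ (+ 1)))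

corollary2p5 R domain _ p n pp p≢2 n≥1 ζ ζ-primitive χ (χ-char , _) ell ψ′ ψ′-char =
  trans (gauss≈sumR R p (2 * n) ζ _) (
  trans (reflexive (cong (λ M → sumR R M _) (≡.sym K*K≡p^[2n]))) (
  trans (TwistedGaussSum.twisted-gauss-sum R domain (2≤p^n p≥2 n≥1)
           (isPrimitiveRoot-e[1/p^n] R {p} {n} p≥2 ζ-primitive)
           (subst (λ q → IsDirichletChar R q χ) (≡.sym K*K≡p^[2n]) χ-char) ψ′-char
           (χ[1+p^n·m]·ω^m≈1 R {p} {n} {ζ} {χ} pp p≥3 n≥1 (proj₁ ζ-primitive) ell))
        (*-congˡ (sym (trans (eP≈^ R p (2 * n) ζ 1) (*-identityʳ _))))))
  where
  open CommutativeRing R using (trans; sym; reflexive; *-congˡ; *-identityʳ)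
  p≥3 : 3 ≤ p
  p≥3 = odd-prime≥3 pp p≢2
  p≥2 : 2 ≤ p
  p≥2 = ℕ.≤-trans (s≤s (s≤s z≤n)) p≥3
  K*K≡p^[2n] : p ^ n * p ^ n ≡ p ^ (2 * n)
  K*K≡p^[2n] = p^n*p^n≡p^[2n] p n
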